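{- Let $D\in\mathbb{N}$. Given any $M\in\mathcal{M}_D$ and $j\in\mathbb{N}$, there exist a matrix $M'\in\mathcal{M}_D$, an integer $m\ge0$, and integers $d_0\ge-1$ and $d_1,\dots,d_m\in\mathbb{N}$ such that $$MJA_j=A_{d_0}JA_{d_1}JA_{d_2}\cdots JA_{d_m}M'.$$ Moreover, if $d_0=-1$ then $m\ge1$.
   Context: For $i\in\mathbb{Z}$ let $A_i=\begin{pmatrix}1&i\\0&1\end{pmatrix}$ and $J=\begin{pmatrix}0&1\\1&0\end{pmatrix}$. For $D\in\mathbb{N}$, $\mathcal{M}_D$ is the set of integer $2\times2$ matrices $\begin{pmatrix}\alpha&\beta\\ \gamma&\delta\end{pmatrix}$ of determinant $\pm D$ satisfying one of: (I) $\gamma=0$, $\beta\ge0$, $\alpha,\delta>0$, $\beta<\delta$; (II) $\delta=0$, $\alpha\ge0$, $\beta,\gamma>0$, $\alpha<\gamma$; (III) $\alpha=0$, $\delta\ge0$, $\beta,\gamma>0$, $\delta<\beta$; (IV) $\beta=0$, $\gamma\ge0$, $\alpha,\delta>0$, $\gamma<\alpha$; (V) $\alpha<0$, $\beta,\gamma,\delta>0$, $|\alpha|<\gamma$; (VI) $\beta<0$, $\alpha,\gamma,\delta>0$, $|\beta|<\delta$. -}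

module Defs where

open import Data.Integer using (ℤ; +_; -_; _+_; _*_; _-_; _<_; _≤_; ∣_∣)
open import Data.Nat using (ℕ)
open import Data.Product using (_×_)
open import Data.Sum using (_⊎_)
open import Data.List using (List; []; _∷_)
open import Relation.Binary.PropositionalEquality using (_≡_)

record Mat : Set where
  constructor mat
  field
    a b c d : ℤ
open Mat public

infixl 7 _⊗_
_⊗_ : Mat → Mat → Mat
mat a₁ b₁ c₁ d₁ ⊗ mat a₂ b₂ c₂ d₂ =
  mat (a₁ * a₂ + b₁ * c₂) (a₁ * b₂ + b₁ * d₂)
      (c₁ * a₂ + d₁ * c₂) (c₁ * b₂ + d₁ * d₂)

det : Mat → ℤ
det (mat α β γ δ) = α * δ - β * γ

I₂ : Mat
I₂ = mat (+ 1) (+ 0) (+ 0) (+ 1)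

A : ℤ → Mat
A i = mat (+ 1) i (+ 0) (+ 1)

J : Mat
J = mat (+ 0) (+ 1) (+ 1) (+ 0)

ShapeI ShapeII ShapeIII ShapeIV ShapeV ShapeVI : Mat → Set
ShapeI   (mat α β γ δ) = γ ≡ + 0 × + 0 ≤ β × + 0 < α × + 0 < δ × β < δ
ShapeII  (mat α β γ δ) = δ ≡ + 0 × + 0 ≤ α × + 0 < β × + 0 < γ × α < γ
ShapeIII (mat α β γ δ) = α ≡ + 0 × + 0 ≤ δ × + 0 < β × + 0 < γ × δ < β
ShapeIV  (mat α β γ δ) = β ≡ + 0 × + 0 ≤ γ × + 0 < α × + 0 < δ × γ < α
ShapeV   (mat α β γ δ) = α < + 0 × + 0 < β × + 0 < γ × + 0 < δ × + ∣ α ∣ < γ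
ShapeVI  (mat α β γ δ) = β < + 0 × + 0 < α × + 0 < γ × + 0 < δ × + ∣ β ∣ < δ

InM : ℕ → Mat → Set
InM D M = (det M ≡ + D ⊎ det M ≡ - (+ D))
        × (ShapeI M ⊎ ShapeII M ⊎ ShapeIII M ⊎ ShapeIV M ⊎ ShapeV M ⊎ ShapeVI M)

JAchain : List ℕ → Mat
JAchain []       = I₂
JAchain (x ∷ xs) = J ⊗ A (+ x) ⊗ JAchain xs

-- A non-negative matrix N of determinant ±D is peeled from the left: if its bottom row is
-- entrywise below its top row then N = A₁ N′, if above then N = J A₁ N′, with N′ non-negative
-- and of smaller entry sum (the subtracted row is non-zero as det N ≠ 0); these factors
-- collect into A_{d₀} J A_{d₁} ⋯ J A_{d_m}. When the rows cross, N already has one of the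
-- shapes (I)–(IV), or N = J A₁ W with W of shape (V) or (VI).
-- Now M J A_j = (β, βj + α; δ, δj + γ) is non-negative for M of shape (I)–(IV); for shapes
-- (V) and (VI), A₁ M J A_j is even positive, and d₀ = -1 comes from peeling it. Since a
-- positive matrix is never in 𝓜_D, that peeling cannot end with m = 0 and d₀ = -1.
module Submission where

open import Defs
open import Data.Nat using (ℕ; zero; suc; _≤_; _<_; z≤n; s≤s; _≤?_)
import Data.Nat.Properties as ℕₚ
import Data.Nat.Tactic.RingSolver as ℕ-Solver
open import Data.Integer using (ℤ; +_; -_; -1ℤ; -[1+_]; +≤+; +<+; -<+; -≤+) renaming (_+_ to _ℤ+_)
import Data.Integer.Properties as ℤₚ
open import Data.Integer.Tactic.RingSolver using (solve-∀)
open import Data.List using (List; length; []; _∷_)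
open import Data.List.Relation.Unary.All using (All; []; _∷_)
open import Data.Product using (Σ; ∃; _×_; _,_)
open import Data.Sum using (_⊎_; inj₁; inj₂)
open import Data.Empty using (⊥-elim)
open import Relation.Nullary using (¬_; yes; no)
open import Relation.Binary.PropositionalEquality
  using (_≡_; refl; sym; trans; cong; subst; module ≡-Reasoning)

module _ where
  open Data.Integer using (_+_; _*_; _-_)

  mat-cong : ∀ {a b c d a′ b′ c′ d′} → a ≡ a′ → b ≡ b′ → c ≡ c′ → d ≡ d′ →
             mat a b c d ≡ mat a′ b′ c′ d′
  mat-cong refl refl refl refl = refl

  ⊗-assoc : ∀ X Y W → X ⊗ Y ⊗ W ≡ X ⊗ (Y ⊗ W)
  ⊗-assoc (mat a b c d) (mat e f g h) (mat i j k l) =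
    mat-cong (entry a b e f g h i k) (entry a b e f g h j l)
             (entry c d e f g h i k) (entry c d e f g h j l)
    where
    entry : ∀ a b e f g h i k →
      (a * e + b * g) * i + (a * f + b * h) * k ≡ a * (e * i + f * k) + b * (g * i + h * k)
    entry = solve-∀

  ⊗-identityˡ : ∀ X → I₂ ⊗ X ≡ X
  ⊗-identityˡ (mat a b c d) = mat-cong (top a c) (top b d) (bottom a c) (bottom b d)
    where
    top : ∀ a c → + 1 * a + + 0 * c ≡ a
    top = solve-∀
    bottom : ∀ a c → + 0 * a + + 1 * c ≡ c
    bottom = solve-∀

  A-+ : ∀ x y → A x ⊗ A y ≡ A (x + y)
  A-+ x y = mat-cong (top-left x) (top-right x y) refl (bottom-right y)
    where
    top-left : ∀ x → + 1 * + 1 + x * + 0 ≡ + 1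
    top-left = solve-∀
    top-right : ∀ x y → + 1 * y + x * + 1 ≡ x + y
    top-right = solve-∀
    bottom-right : ∀ y → + 0 * y + + 1 * + 1 ≡ + 1
    bottom-right = solve-∀

  A₁⊗ : ∀ a b c d → A (+ 1) ⊗ mat a b c d ≡ mat (a + c) (b + d) c d
  A₁⊗ a b c d = mat-cong (top a c) (top b d) (bottom a c) (bottom b d)
    where
    top : ∀ a c → + 1 * a + + 1 * c ≡ a + c
    top = solve-∀
    bottom : ∀ a c → + 0 * a + + 1 * c ≡ c
    bottom = solve-∀

  JA₁⊗ : ∀ a b c d → J ⊗ A (+ 1) ⊗ mat a b c d ≡ mat c d (a + c) (b + d)
  JA₁⊗ a b c d = mat-cong (top a c) (top b d) (bottom a c) (bottom b d)
    where
    top : ∀ a c → + 0 * a + + 1 * c ≡ c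
    top = solve-∀
    bottom : ∀ a c → + 1 * a + + 1 * c ≡ a + c
    bottom = solve-∀

  ⊗J⊗A : ∀ α β γ δ j → mat α β γ δ ⊗ J ⊗ A j ≡ mat β (β * j + α) δ (δ * j + γ)
  ⊗J⊗A α β γ δ j = mat-cong (left α β) (right α β j) (left γ δ) (right γ δ j)
    where
    left : ∀ a b → (a * + 0 + b * + 1) * + 1 + (a * + 1 + b * + 0) * + 0 ≡ b
    left = solve-∀
    right : ∀ a b j → (a * + 0 + b * + 1) * j + (a * + 1 + b * + 0) * + 1 ≡ b * j + a
    right = solve-∀

  det-⊗ : ∀ X Y → det (X ⊗ Y) ≡ det X * det Y
  det-⊗ (mat a b c d) (mat e f g h) = identity a b c d e f g h
    where
    identity : ∀ a b c d e f g h →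
      (a * e + b * g) * (c * f + d * h) - (a * f + b * h) * (c * e + d * g) ≡
      (a * d - b * c) * (e * h - f * g)
    identity = solve-∀

  det-A₁⊗ : ∀ W → det (A (+ 1) ⊗ W) ≡ det W
  det-A₁⊗ W = trans (det-⊗ (A (+ 1)) W) (ℤₚ.*-identityˡ (det W))

  det-JA₁⊗ : ∀ W → det (J ⊗ A (+ 1) ⊗ W) ≡ - det W
  det-JA₁⊗ W = trans (det-⊗ (J ⊗ A (+ 1)) W) (ℤₚ.-1*i≡-i (det W))

  det-⊗J⊗A : ∀ M j → det (M ⊗ J ⊗ A j) ≡ - det M
  det-⊗J⊗A (mat α β γ δ) j = trans (cong det (⊗J⊗A α β γ δ j)) (identity α β γ δ j)
    where
    identity : ∀ α β γ δ j → β * (δ * j + γ) - (β * j + α) * δ ≡ - (α * δ - β * γ)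
    identity = solve-∀

  det-zero-bottom-row : ∀ a b → det (mat a b (+ 0) (+ 0)) ≡ + 0
  det-zero-bottom-row a b = identity a b
    where
    identity : ∀ a b → a * + 0 - b * + 0 ≡ + 0
    identity = solve-∀

  -[1+m]+[1+m+n]≡n : ∀ m n → -[1+ m ] + + (suc m Data.Nat.+ n) ≡ + n
  -[1+m]+[1+m+n]≡n m n =
    trans (ℤₚ.⊖-≥ (ℕₚ.m≤m+n (suc m) n)) (cong +_ (ℕₚ.m+n∸m≡n (suc m) n))

open import Data.Nat using (_+_; _*_; _∸_)

infix 4 _≡±_
_≡±_ : ℤ → ℕ → Set
z ≡± D = z ≡ + D ⊎ z ≡ - (+ D)

≡±-neg : ∀ {z D} → z ≡± D → - z ≡± D
≡±-neg (inj₁ refl) = inj₂ refl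
≡±-neg {D = D} (inj₂ refl) = inj₁ (ℤₚ.neg-involutive (+ D))

0≢±D : ∀ {D} → 1 ≤ D → ¬ (+ 0 ≡± D)
0≢±D (s≤s _) (inj₁ ())
0≢±D (s≤s _) (inj₂ ())

≡±-A₁⊗ : ∀ {D N W} → N ≡ A (+ 1) ⊗ W → det N ≡± D → det W ≡± D
≡±-A₁⊗ {D} {W = W} refl = subst (_≡± D) (det-A₁⊗ W)

≡±-JA₁⊗ : ∀ {D N W} → N ≡ J ⊗ A (+ 1) ⊗ W → det N ≡± D → det W ≡± D
≡±-JA₁⊗ {D} {W = W} refl det± =
  subst (_≡± D) (ℤₚ.neg-involutive (det W)) (subst (λ z → - z ≡± D) (det-JA₁⊗ W) (≡±-neg det±))

≡±-⊗J⊗A : ∀ {D} M j → det M ≡± D → det (M ⊗ J ⊗ A j) ≡± D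
≡±-⊗J⊗A {D} M j det± = subst (_≡± D) (sym (det-⊗J⊗A M j)) (≡±-neg det±)

ℕmat : ℕ → ℕ → ℕ → ℕ → Mat
ℕmat p q r s = mat (+ p) (+ q) (+ r) (+ s)

top-row≢0 : ∀ {D p q r s} → 1 ≤ D → det (ℕmat p q r s) ≡± D → 0 < p + q
top-row≢0 {p = zero} {zero} D≥1 det± = ⊥-elim (0≢±D D≥1 det±)
top-row≢0 {p = zero} {suc q} _ _ = s≤s z≤n
top-row≢0 {p = suc p} _ _ = s≤s z≤n

bottom-row≢0 : ∀ {D p q r s} → 1 ≤ D → det (ℕmat p q r s) ≡± D → 0 < r + s
bottom-row≢0 {D} {p} {q} {zero} {zero} D≥1 det± =
  ⊥-elim (0≢±D D≥1 (subst (_≡± D) (det-zero-bottom-row (+ p) (+ q)) det±))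
bottom-row≢0 {r = zero} {suc s} _ _ = s≤s z≤n
bottom-row≢0 {r = suc r} _ _ = s≤s z≤n

record Factorisation (D : ℕ) (N : Mat) : Set where
  constructor factorisation
  field
    d₀ : ℕ
    ds : List ℕ
    M′ : Mat
    M′∈𝓜 : InM D M′
    ds≥1 : All (1 ≤_) ds
    factors : N ≡ A (+ d₀) ⊗ JAchain ds ⊗ M′

⊗-assoc₄ : ∀ X Y Z W → X ⊗ (Y ⊗ Z ⊗ W) ≡ X ⊗ Y ⊗ Z ⊗ W
⊗-assoc₄ X Y Z W = begin
  X ⊗ (Y ⊗ Z ⊗ W)   ≡⟨ sym (⊗-assoc X (Y ⊗ Z) W) ⟩
  X ⊗ (Y ⊗ Z) ⊗ W   ≡⟨ cong (_⊗ W) (sym (⊗-assoc X Y Z)) ⟩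
  X ⊗ Y ⊗ Z ⊗ W     ∎
  where open ≡-Reasoning

A⊗A⊗ : ∀ x y C W → A x ⊗ (A y ⊗ C ⊗ W) ≡ A (x ℤ+ y) ⊗ C ⊗ W
A⊗A⊗ x y C W = trans (⊗-assoc₄ (A x) (A y) C W) (cong (λ X → X ⊗ C ⊗ W) (A-+ x y))

in𝓜⇒Factorisation : ∀ {D M} → InM D M → Factorisation D M
in𝓜⇒Factorisation {M = M} M∈𝓜 = factorisation 0 [] M M∈𝓜 [] (sym (⊗-identityˡ M))

Factorisation-A₁⊗ : ∀ {D N W} → N ≡ A (+ 1) ⊗ W → Factorisation D W → Factorisation D N
Factorisation-A₁⊗ {N = N} {W} N≡ (factorisation e ds M′ M′∈𝓜 ds≥1 W≡) =
  factorisation (suc e) ds M′ M′∈𝓜 ds≥1 (begin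
    N                                ≡⟨ N≡ ⟩
    A (+ 1) ⊗ W                      ≡⟨ cong (A (+ 1) ⊗_) W≡ ⟩
    A (+ 1) ⊗ (A (+ e) ⊗ C ⊗ M′)     ≡⟨ A⊗A⊗ (+ 1) (+ e) C M′ ⟩
    A (+ suc e) ⊗ C ⊗ M′             ∎)
  where
  open ≡-Reasoning
  C : Mat
  C = JAchain ds

Factorisation-JA₁⊗ : ∀ {D N W} → N ≡ J ⊗ A (+ 1) ⊗ W → Factorisation D W → Factorisation D N
Factorisation-JA₁⊗ {N = N} {W} N≡ (factorisation e ds M′ M′∈𝓜 ds≥1 W≡) =
  factorisation 0 (suc e ∷ ds) M′ M′∈𝓜 (s≤s z≤n ∷ ds≥1) (begin
    N                                   ≡⟨ N≡ ⟩
    J ⊗ A (+ 1) ⊗ W                     ≡⟨ cong (J ⊗ A (+ 1) ⊗_) W≡ ⟩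
    J ⊗ A (+ 1) ⊗ (A (+ e) ⊗ C ⊗ M′)    ≡⟨ ⊗-assoc₄ (J ⊗ A (+ 1)) (A (+ e)) C M′ ⟩
    J ⊗ A (+ 1) ⊗ A (+ e) ⊗ C ⊗ M′      ≡⟨ cong (λ X → X ⊗ C ⊗ M′) JA₁A ⟩
    J ⊗ A (+ suc e) ⊗ C ⊗ M′            ≡⟨ cong (_⊗ M′) (sym (⊗-identityˡ (J ⊗ A (+ suc e) ⊗ C))) ⟩
    A (+ 0) ⊗ (J ⊗ A (+ suc e) ⊗ C) ⊗ M′ ∎)
  where
  open ≡-Reasoning
  C : Mat
  C = JAchain ds
  JA₁A : J ⊗ A (+ 1) ⊗ A (+ e) ≡ J ⊗ A (+ suc e)
  JA₁A = trans (⊗-assoc J (A (+ 1)) (A (+ e))) (cong (J ⊗_) (A-+ (+ 1) (+ e)))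

data RowOrder : ℕ → ℕ → ℕ → ℕ → Set where
  bottom≤top : ∀ k₁ k₂ y₁ y₂ → RowOrder (k₁ + y₁) (k₂ + y₂) y₁ y₂
  top≤bottom : ∀ k₁ k₂ x₁ x₂ → RowOrder x₁ x₂ (k₁ + x₁) (k₂ + x₂)
  crossing   : ∀ k₁ k₂ y₁ x₂ → RowOrder (suc k₁ + y₁) x₂ y₁ (suc k₂ + x₂)
  crossing′  : ∀ k₁ k₂ x₁ y₂ → RowOrder x₁ (suc k₂ + y₂) (suc k₁ + x₁) y₂

≤⇒∃[k]k+m≡n : ∀ {m n} → m ≤ n → ∃ λ k → k + m ≡ n
≤⇒∃[k]k+m≡n m≤n = _ , ℕₚ.m∸n+n≡m m≤n

<⇒∃[k]1+k+m≡n : ∀ {m n} → m < n → ∃ λ k → suc k + m ≡ n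
<⇒∃[k]1+k+m≡n {m} m<n with ≤⇒∃[k]k+m≡n m<n
... | k , k+1+m≡n = k , trans (sym (ℕₚ.+-suc k m)) k+1+m≡n

private module _ {x₁ x₂ y₁ y₂ : ℕ} where
  below : y₁ ≤ x₁ → y₂ ≤ x₂ → RowOrder x₁ x₂ y₁ y₂
  below y₁≤x₁ y₂≤x₂ with ≤⇒∃[k]k+m≡n y₁≤x₁ | ≤⇒∃[k]k+m≡n y₂≤x₂
  ... | k₁ , refl | k₂ , refl = bottom≤top k₁ k₂ y₁ y₂

  above : x₁ ≤ y₁ → x₂ ≤ y₂ → RowOrder x₁ x₂ y₁ y₂
  above x₁≤y₁ x₂≤y₂ with ≤⇒∃[k]k+m≡n x₁≤y₁ | ≤⇒∃[k]k+m≡n x₂≤y₂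
  ... | k₁ , refl | k₂ , refl = top≤bottom k₁ k₂ x₁ x₂

  cross : y₁ < x₁ → x₂ < y₂ → RowOrder x₁ x₂ y₁ y₂
  cross y₁<x₁ x₂<y₂ with <⇒∃[k]1+k+m≡n y₁<x₁ | <⇒∃[k]1+k+m≡n x₂<y₂
  ... | k₁ , refl | k₂ , refl = crossing k₁ k₂ y₁ x₂

  cross′ : x₁ < y₁ → y₂ < x₂ → RowOrder x₁ x₂ y₁ y₂
  cross′ x₁<y₁ y₂<x₂ with <⇒∃[k]1+k+m≡n x₁<y₁ | <⇒∃[k]1+k+m≡n y₂<x₂
  ... | k₁ , refl | k₂ , refl = crossing′ k₁ k₂ x₁ y₂

rowOrder : ∀ x₁ x₂ y₁ y₂ → RowOrder x₁ x₂ y₁ y₂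
rowOrder x₁ x₂ y₁ y₂ with y₁ ≤? x₁ | y₂ ≤? x₂
... | yes y₁≤x₁ | yes y₂≤x₂ = below y₁≤x₁ y₂≤x₂
... | no y₁≰x₁ | no y₂≰x₂ = above (ℕₚ.<⇒≤ (ℕₚ.≰⇒> y₁≰x₁)) (ℕₚ.<⇒≤ (ℕₚ.≰⇒> y₂≰x₂))
... | yes _ | no y₂≰x₂ with x₁ ≤? y₁
...   | yes x₁≤y₁ = above x₁≤y₁ (ℕₚ.<⇒≤ (ℕₚ.≰⇒> y₂≰x₂))
...   | no x₁≰y₁ = cross (ℕₚ.≰⇒> x₁≰y₁) (ℕₚ.≰⇒> y₂≰x₂)
rowOrder x₁ x₂ y₁ y₂ | no y₁≰x₁ | yes _ with x₂ ≤? y₂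
...   | yes x₂≤y₂ = above (ℕₚ.<⇒≤ (ℕₚ.≰⇒> y₁≰x₁)) x₂≤y₂
...   | no x₂≰y₂ = cross′ (ℕₚ.≰⇒> y₁≰x₁) (ℕₚ.≰⇒> x₂≰y₂)

factorise-crossing : ∀ {D} k₁ k₂ y₁ x₂ → det (ℕmat (suc k₁ + y₁) x₂ y₁ (suc k₂ + x₂)) ≡± D →
  Factorisation D (ℕmat (suc k₁ + y₁) x₂ y₁ (suc k₂ + x₂))
factorise-crossing k₁ k₂ zero x₂ det± = in𝓜⇒Factorisation (det± , inj₁
  (refl , +≤+ z≤n , +<+ (s≤s z≤n) , +<+ (s≤s z≤n) , +<+ (s≤s (ℕₚ.m≤n+m x₂ k₂))))
factorise-crossing k₁ k₂ (suc y₁) zero det± = in𝓜⇒Factorisation (det± , inj₂ (inj₂ (inj₂ (inj₁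
  (refl , +≤+ z≤n , +<+ (s≤s z≤n) , +<+ (s≤s z≤n) , +<+ (s≤s (ℕₚ.m≤n+m (suc y₁) k₁)))))))
factorise-crossing k₁ k₂ (suc y₁) (suc x₂) det± =
  Factorisation-JA₁⊗ {W = W} N≡
    (in𝓜⇒Factorisation (≡±-JA₁⊗ {W = W} N≡ det± , inj₂ (inj₂ (inj₂ (inj₂ (inj₁ W-shapeV))))))
  where
  W : Mat
  W = mat -[1+ k₁ ] (+ suc k₂) (+ (suc k₁ + suc y₁)) (+ suc x₂)
  W-shapeV : ShapeV W
  W-shapeV = -<+ , +<+ (s≤s z≤n) , +<+ (s≤s z≤n) , +<+ (s≤s z≤n) , +<+ (ℕₚ.m<m+n (suc k₁) (s≤s z≤n))
  N≡ : ℕmat (suc k₁ + suc y₁) (suc x₂) (suc y₁) (suc k₂ + suc x₂) ≡ J ⊗ A (+ 1) ⊗ W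
  N≡ = sym (trans (JA₁⊗ (W .a) (W .b) (W .c) (W .d))
                  (mat-cong refl refl (-[1+m]+[1+m+n]≡n k₁ (suc y₁)) refl))

factorise-crossing′ : ∀ {D} k₁ k₂ x₁ y₂ → det (ℕmat x₁ (suc k₂ + y₂) (suc k₁ + x₁) y₂) ≡± D →
  Factorisation D (ℕmat x₁ (suc k₂ + y₂) (suc k₁ + x₁) y₂)
factorise-crossing′ k₁ k₂ zero y₂ det± = in𝓜⇒Factorisation (det± , inj₂ (inj₂ (inj₁
  (refl , +≤+ z≤n , +<+ (s≤s z≤n) , +<+ (s≤s z≤n) , +<+ (s≤s (ℕₚ.m≤n+m y₂ k₂))))))
factorise-crossing′ k₁ k₂ (suc x₁) zero det± = in𝓜⇒Factorisation (det± , inj₂ (inj₁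
  (refl , +≤+ z≤n , +<+ (s≤s z≤n) , +<+ (s≤s z≤n) , +<+ (s≤s (ℕₚ.m≤n+m (suc x₁) k₁)))))
factorise-crossing′ k₁ k₂ (suc x₁) (suc y₂) det± =
  Factorisation-JA₁⊗ {W = W} N≡
    (in𝓜⇒Factorisation (≡±-JA₁⊗ {W = W} N≡ det± , inj₂ (inj₂ (inj₂ (inj₂ (inj₂ W-shapeVI))))))
  where
  W : Mat
  W = mat (+ suc k₁) -[1+ k₂ ] (+ suc x₁) (+ (suc k₂ + suc y₂))
  W-shapeVI : ShapeVI W
  W-shapeVI =
    -<+ , +<+ (s≤s z≤n) , +<+ (s≤s z≤n) , +<+ (s≤s z≤n) , +<+ (ℕₚ.m<m+n (suc k₂) (s≤s z≤n))
  N≡ : ℕmat (suc x₁) (suc k₂ + suc y₂) (suc k₁ + suc x₁) (suc y₂) ≡ J ⊗ A (+ 1) ⊗ W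
  N≡ = sym (trans (JA₁⊗ (W .a) (W .b) (W .c) (W .d))
                  (mat-cong refl refl refl (-[1+m]+[1+m+n]≡n k₂ (suc y₂))))

<-shrink : ∀ {a b n} → a + b < suc n → 0 < b → a < n
<-shrink {a} a+b<1+n b>0 = ℕₚ.<-≤-trans (ℕₚ.m<m+n a b>0) (ℕₚ.≤-pred a+b<1+n)

factorise-< : ∀ {D} → 1 ≤ D → ∀ n p q r s → p + q + r + s < n →
  det (ℕmat p q r s) ≡± D → Factorisation D (ℕmat p q r s)
factorise-< D≥1 (suc n) p q r s bound det± with rowOrder p q r s
... | bottom≤top k₁ k₂ y₁ y₂ =
  Factorisation-A₁⊗ N≡ (factorise-< D≥1 n k₁ k₂ y₁ y₂ bound′ (≡±-A₁⊗ {W = W} N≡ det±))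
  where
  W : Mat
  W = ℕmat k₁ k₂ y₁ y₂
  N≡ : ℕmat (k₁ + y₁) (k₂ + y₂) y₁ y₂ ≡ A (+ 1) ⊗ W
  N≡ = sym (A₁⊗ (+ k₁) (+ k₂) (+ y₁) (+ y₂))
  sum : ∀ k₁ k₂ y₁ y₂ → (k₁ + y₁) + (k₂ + y₂) + y₁ + y₂ ≡ k₁ + k₂ + y₁ + y₂ + (y₁ + y₂)
  sum = ℕ-Solver.solve-∀
  bound′ : k₁ + k₂ + y₁ + y₂ < n
  bound′ = <-shrink (subst (_< suc n) (sum k₁ k₂ y₁ y₂) bound)
                    (bottom-row≢0 {p = k₁ + y₁} {k₂ + y₂} {y₁} {y₂} D≥1 det±)
... | top≤bottom k₁ k₂ x₁ x₂ =
  Factorisation-JA₁⊗ N≡ (factorise-< D≥1 n k₁ k₂ x₁ x₂ bound′ (≡±-JA₁⊗ {W = W} N≡ det±))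
  where
  W : Mat
  W = ℕmat k₁ k₂ x₁ x₂
  N≡ : ℕmat x₁ x₂ (k₁ + x₁) (k₂ + x₂) ≡ J ⊗ A (+ 1) ⊗ W
  N≡ = sym (JA₁⊗ (+ k₁) (+ k₂) (+ x₁) (+ x₂))
  sum : ∀ k₁ k₂ x₁ x₂ → x₁ + x₂ + (k₁ + x₁) + (k₂ + x₂) ≡ k₁ + k₂ + x₁ + x₂ + (x₁ + x₂)
  sum = ℕ-Solver.solve-∀
  bound′ : k₁ + k₂ + x₁ + x₂ < n
  bound′ = <-shrink (subst (_< suc n) (sum k₁ k₂ x₁ x₂) bound)
                    (top-row≢0 {p = x₁} {x₂} {k₁ + x₁} {k₂ + x₂} D≥1 det±)
... | crossing k₁ k₂ y₁ x₂ = factorise-crossing k₁ k₂ y₁ x₂ det±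
... | crossing′ k₁ k₂ x₁ y₂ = factorise-crossing′ k₁ k₂ x₁ y₂ det±

factorise : ∀ {D N p q r s} → 1 ≤ D → N ≡ ℕmat p q r s → det N ≡± D → Factorisation D N
factorise {p = p} {q} {r} {s} D≥1 refl = factorise-< D≥1 _ p q r s ℕₚ.≤-refl

Factorisation₋₁ : ℕ → Mat → Set
Factorisation₋₁ D N = Σ Mat λ M′ → InM D M′ × Σ ℤ λ d₀ → Σ (List ℕ) λ ds →
  (-1ℤ Data.Integer.≤ d₀) × All (λ d → 1 ≤ d) ds ×
  (N ≡ A d₀ ⊗ JAchain ds ⊗ M′) ×
  (d₀ ≡ -1ℤ → 1 ≤ length ds)

Factorisation⇒Factorisation₋₁ : ∀ {D N} → Factorisation D N → Factorisation₋₁ D N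
Factorisation⇒Factorisation₋₁ (factorisation e ds M′ M′∈𝓜 ds≥1 N≡) =
  M′ , M′∈𝓜 , + e , ds , -≤+ , ds≥1 , N≡ , λ ()

positive∉𝓜 : ∀ {D p q r s} → ¬ InM D (ℕmat (suc p) (suc q) (suc r) (suc s))
positive∉𝓜 (_ , inj₁ (() , _))
positive∉𝓜 (_ , inj₂ (inj₁ (() , _)))
positive∉𝓜 (_ , inj₂ (inj₂ (inj₁ (() , _))))
positive∉𝓜 (_ , inj₂ (inj₂ (inj₂ (inj₁ (() , _)))))
positive∉𝓜 (_ , inj₂ (inj₂ (inj₂ (inj₂ (inj₁ (+<+ () , _))))))
positive∉𝓜 (_ , inj₂ (inj₂ (inj₂ (inj₂ (inj₂ (+<+ () , _))))))

Factorisation₋₁-A₁⊗ : ∀ {D N p q r s} → 1 ≤ D →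
  A (+ 1) ⊗ N ≡ ℕmat (suc p) (suc q) (suc r) (suc s) → det N ≡± D → Factorisation₋₁ D N
Factorisation₋₁-A₁⊗ {D} {N} D≥1 A₁N≡ det±
  with factorise D≥1 A₁N≡ (subst (_≡± D) (sym (det-A₁⊗ N)) det±)
... | factorisation e ds M′ M′∈𝓜 ds≥1 A₁N≡′ =
  M′ , M′∈𝓜 , -1ℤ ℤ+ + e , ds , ℤₚ.-[1+m]≤n⊖m+1 0 e , ds≥1 , N≡ , nonempty e ds A₁N≡′
  where
  open ≡-Reasoning
  N≡ : N ≡ A (-1ℤ ℤ+ + e) ⊗ JAchain ds ⊗ M′
  N≡ = begin
    N                                    ≡⟨ sym (⊗-identityˡ N) ⟩
    A -1ℤ ⊗ A (+ 1) ⊗ N                  ≡⟨ ⊗-assoc (A -1ℤ) (A (+ 1)) N ⟩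
    A -1ℤ ⊗ (A (+ 1) ⊗ N)                ≡⟨ cong (A -1ℤ ⊗_) A₁N≡′ ⟩
    A -1ℤ ⊗ (A (+ e) ⊗ JAchain ds ⊗ M′)  ≡⟨ A⊗A⊗ -1ℤ (+ e) (JAchain ds) M′ ⟩
    A (-1ℤ ℤ+ + e) ⊗ JAchain ds ⊗ M′     ∎
  nonempty : ∀ e ds → A (+ 1) ⊗ N ≡ A (+ e) ⊗ JAchain ds ⊗ M′ → -1ℤ ℤ+ + e ≡ -1ℤ → 1 ≤ length ds
  nonempty zero [] A₁N≡M′ _ =
    ⊥-elim (positive∉𝓜
      (subst (InM D) (trans (sym (⊗-identityˡ M′)) (trans (sym A₁N≡M′) A₁N≡)) M′∈𝓜))
  nonempty zero (_ ∷ _) _ _ = s≤s z≤n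
  nonempty (suc e) _ _ ()

⊗J⊗A-ℕmat : ∀ p q r s j → ℕmat p q r s ⊗ J ⊗ A (+ j) ≡ ℕmat q (q * j + p) s (s * j + r)
⊗J⊗A-ℕmat p q r s j = trans (⊗J⊗A (+ p) (+ q) (+ r) (+ s) (+ j))
  (mat-cong refl (cong (_ℤ+ + p) (sym (ℤₚ.pos-* q j))) refl (cong (_ℤ+ + r) (sym (ℤₚ.pos-* s j))))

Factorisation₋₁-ℕmat⊗J⊗A : ∀ {D} → 1 ≤ D → ∀ p q r s j → det (ℕmat p q r s) ≡± D →
  Factorisation₋₁ D (ℕmat p q r s ⊗ J ⊗ A (+ j))
Factorisation₋₁-ℕmat⊗J⊗A D≥1 p q r s j det± = Factorisation⇒Factorisation₋₁
  (factorise D≥1 (⊗J⊗A-ℕmat p q r s j) (≡±-⊗J⊗A (ℕmat p q r s) (+ j) det±))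

Factorisation₋₁-⊗J⊗A : ∀ {D} → 1 ≤ D → ∀ M {p q r s j} → 1 ≤ j → 0 < q → 0 < s →
  A (+ 1) ⊗ M ≡ ℕmat p q r s → det M ≡± D → Factorisation₋₁ D (M ⊗ J ⊗ A (+ j))
Factorisation₋₁-⊗J⊗A D≥1 M {p} {suc q} {r} {suc s} {suc j} _ _ _ A₁M≡ det± =
  Factorisation₋₁-A₁⊗ D≥1 A₁N≡ (≡±-⊗J⊗A M (+ suc j) det±)
  where
  A₁N≡ : A (+ 1) ⊗ (M ⊗ J ⊗ A (+ suc j)) ≡
         ℕmat (suc q) (suc q * suc j + p) (suc s) (suc s * suc j + r)
  A₁N≡ = trans (⊗-assoc₄ (A (+ 1)) M J (A (+ suc j)))
    (trans (cong (λ X → X ⊗ J ⊗ A (+ suc j)) A₁M≡) (⊗J⊗A-ℕmat p (suc q) r (suc s) (suc j)))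

A₁⊗-shapeV : ∀ a b c d → suc a < c →
  A (+ 1) ⊗ mat -[1+ a ] (+ b) (+ c) (+ d) ≡ ℕmat (c ∸ suc a) (b + d) c d
A₁⊗-shapeV a b c d a<c =
  trans (A₁⊗ -[1+ a ] (+ b) (+ c) (+ d)) (mat-cong (ℤₚ.⊖-≥ (ℕₚ.<⇒≤ a<c)) refl refl refl)

A₁⊗-shapeVI : ∀ a b c d → suc b < d →
  A (+ 1) ⊗ mat (+ a) -[1+ b ] (+ c) (+ d) ≡ ℕmat (a + c) (d ∸ suc b) c d
A₁⊗-shapeVI a b c d b<d =
  trans (A₁⊗ (+ a) -[1+ b ] (+ c) (+ d)) (mat-cong refl (ℤₚ.⊖-≥ (ℕₚ.<⇒≤ b<d)) refl refl)

lemma2p1 : (D : ℕ) → 1 ≤ D → (M : Mat) → InM D M → (j : ℕ) → 1 ≤ j →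
    Σ Mat λ M′ → InM D M′ × Σ ℤ λ d₀ → Σ (List ℕ) λ ds →
      (-1ℤ Data.Integer.≤ d₀) × All (λ d → 1 ≤ d) ds ×
      (M ⊗ J ⊗ A (+ j) ≡ A d₀ ⊗ JAchain ds ⊗ M′) ×
      (d₀ ≡ -1ℤ → 1 ≤ length ds)
lemma2p1 D D≥1 (mat α β γ δ) (det± , shape) j j≥1 with shape
... | inj₁ (refl , +≤+ {n = q} _ , +<+ {n = p} _ , +<+ {n = s} _ , _) =
  Factorisation₋₁-ℕmat⊗J⊗A D≥1 p q 0 s j det±
... | inj₂ (inj₁ (refl , +≤+ {n = p} _ , +<+ {n = q} _ , +<+ {n = r} _ , _)) =
  Factorisation₋₁-ℕmat⊗J⊗A D≥1 p q r 0 j det±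
... | inj₂ (inj₂ (inj₁ (refl , +≤+ {n = s} _ , +<+ {n = q} _ , +<+ {n = r} _ , _))) =
  Factorisation₋₁-ℕmat⊗J⊗A D≥1 0 q r s j det±
... | inj₂ (inj₂ (inj₂ (inj₁ (refl , +≤+ {n = r} _ , +<+ {n = p} _ , +<+ {n = s} _ , _)))) =
  Factorisation₋₁-ℕmat⊗J⊗A D≥1 p 0 r s j det±
... | inj₂ (inj₂ (inj₂ (inj₂ (inj₁
        (-<+ {m = a} , +<+ {n = b} b>0 , +<+ {n = c} _ , +<+ {n = d} d>0 , +<+ a<c))))) =
  Factorisation₋₁-⊗J⊗A D≥1 (mat -[1+ a ] (+ b) (+ c) (+ d)) j≥1
    (ℕₚ.<-≤-trans b>0 (ℕₚ.m≤m+n b d)) d>0 (A₁⊗-shapeV a b c d a<c) det±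
... | inj₂ (inj₂ (inj₂ (inj₂ (inj₂
        (-<+ {m = b} , +<+ {n = a} _ , +<+ {n = c} _ , +<+ {n = d} d>0 , +<+ b<d))))) =
  Factorisation₋₁-⊗J⊗A D≥1 (mat (+ a) -[1+ b ] (+ c) (+ d)) j≥1
    (ℕₚ.m<n⇒0<n∸m b<d) d>0 (A₁⊗-shapeVI a b c d b<d) det±
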